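{- For $5\le r\le 6$, $\kappa^s(Q_6;K_{1,r})\ge 3$.
   Context: The $n$-dimensional hypercube $Q_n$ has as vertices all binary strings of length $n$, two strings being adjacent iff they differ in exactly one position. $K_{1,r}$ denotes the star with $r$ leaves. For a graph $G$ and a set $F$ of subgraphs of $G$, $G-F$ denotes the graph obtained from $G$ by deleting all vertices of all members of $F$. For a connected graph $T$, $\kappa^s(G;T)$ is the minimum cardinality of a set $F$ of subgraphs of $G$, each isomorphic to a connected subgraph of $T$, such that $G-F$ is disconnected. -}

module Defs where

open import Data.Nat using (ℕ; _≤_)
open import Data.Bool using (Bool)
open import Data.Fin using (Fin)
open import Data.Vec using (Vec; lookup)
open import Data.List using (List; _∷_; length)
open import Data.List.Relation.Unary.All using (All)
open import Data.List.Relation.Unary.Any using (Any)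
open import Data.List.Relation.Unary.Unique.Propositional using (Unique)
open import Data.List.Membership.Propositional using (_∈_)
open import Data.Product using (Σ; _×_)
open import Relation.Binary.PropositionalEquality using (_≡_; _≢_)
open import Relation.Nullary using (¬_)

QVertex : ℕ → Set
QVertex n = Vec Bool n

QAdj : (n : ℕ) → QVertex n → QVertex n → Set
QAdj n u v = Σ (Fin n) λ i →
  (lookup u i ≢ lookup v i) × (∀ j → j ≢ i → lookup u j ≡ lookup v j)

-- A subgraph of Q_n isomorphic to a connected subgraph of K_{1,r}.
-- The connected subgraphs of K_{1,r} are exactly the stars K_{1,s}, 0 ≤ s ≤ r
-- (K_{1,0} = a single vertex).
record Star (n r : ℕ) : Set where
  field
    centre : QVertex n
    leaves : List (QVertex n)
    leaves-distinct : Unique leaves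
    leaves-adjacent : All (QAdj n centre) leaves
    few-leaves : length leaves ≤ r

open Star public

starVertices : ∀ {n r} → Star n r → List (QVertex n)
starVertices s = centre s ∷ leaves s

Deleted : ∀ {n r} → List (Star n r) → QVertex n → Set
Deleted F v = Any (λ s → v ∈ starVertices s) F

data WalkAvoiding {n r : ℕ} (F : List (Star n r)) : QVertex n → QVertex n → Set where
  here : ∀ {u} → ¬ Deleted F u → WalkAvoiding F u u
  step : ∀ {u w v} → ¬ Deleted F u → QAdj n u w → WalkAvoiding F w v → WalkAvoiding F u v

ConnectedAfterDeleting : ∀ {n r} → List (Star n r) → Set
ConnectedAfterDeleting {n} F =
  (u v : QVertex n) → ¬ Deleted F u → ¬ Deleted F v → WalkAvoiding F u v

-- κ^s(Q_n; K_{1,r}) ≥ k : no family of fewer than k such subgraphs disconnects Q_n.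
-- (A set F of subgraphs with |F| < k is represented by a list of length < k.)
KappaStarAtLeast : ℕ → ℕ → ℕ → Set
KappaStarAtLeast n r k =
  (F : List (Star n r)) → Data.Nat.suc (length F) ≤ k → ConnectedAfterDeleting F

-- The vertices of at most two stars lie in the closed unit balls around their centres c₁ and c₂, and
-- every vertex at distance at least 2 from both centres survives.  Translating by c₁ moves c₁ to the
-- origin, which leaves 64 choices for c₂.  For each of them a computation checks that every vertex other
-- than the two centres either lies outside both balls and reaches a fixed hub by a greedy walk that stays
-- outside both balls, or has a neighbour that does.  Any two surviving vertices other than the centres
-- are then joined through the hub, and when there is no star at all the centre is chosen away from them.
module Submission where

open import Data.Bool using (Bool; true; false; not; _∧_; _∨_; _xor_; if_then_else_; T)
import Data.Bool as Bool
open import Data.Bool.Properties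
  using (xor-assoc; xor-comm; xor-same; xor-identityˡ; xor-identityʳ; xor-inverseʳ;
         not-distribˡ-xor; not-¬; ¬-not; T-∧; T-∨)
open import Data.Empty using (⊥-elim)
open import Data.Fin using (Fin; zero; suc) renaming (_≟_ to _≟ᶠ_)
open import Data.List using (List; []; _∷_)
open import Data.List.Membership.Propositional using (_∈_)
open import Data.List.Relation.Unary.All as All using ()
open import Data.List.Relation.Unary.Any as Any using (here; there)
open import Data.Nat using (ℕ; zero; suc; _≤_; s≤s; _≤ᵇ_; _<ᵇ_)
open import Data.Nat.Properties using (≤⇒≤ᵇ; ≤-reflexive; m≤n⇒m≤1+n)
open import Data.Product using (∃; _×_; _,_; proj₁; proj₂)
open import Data.Sum as Sum using (_⊎_; inj₁; inj₂)
open import Data.Vec using (Vec; []; _∷_; lookup; replicate; zipWith; updateAt; countᵇ; tabulate; head; tail)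
open import Data.Vec.Properties
  using (≡-dec; zipWith-assoc; zipWith-comm; zipWith-identityˡ; zipWith-identityʳ;
         lookup∘updateAt; lookup∘updateAt′; tabulate∘lookup; tabulate-cong)
open import Function using (_∘_; id)
open import Function.Bundles using (Equivalence)
open import Relation.Binary.PropositionalEquality
  using (_≡_; _≢_; refl; sym; trans; cong; cong₂; subst; module ≡-Reasoning)
open import Relation.Nullary using (¬_; yes; no)
open import Relation.Nullary.Decidable using (⌊_⌋; toWitness)

open import Defs

private
  variable
    n r : ℕ

infixl 6 _⊕_

_⊕_ : Vec Bool n → Vec Bool n → Vec Bool n
_⊕_ = zipWith _xor_

origin : Vec Bool n
origin = replicate _ false

⊕-identityˡ : (x : Vec Bool n) → origin ⊕ x ≡ x
⊕-identityˡ = zipWith-identityˡ xor-identityˡ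

⊕-self : (x : Vec Bool n) → x ⊕ x ≡ origin
⊕-self []      = refl
⊕-self (a ∷ x) = cong₂ _∷_ (xor-same a) (⊕-self x)

⊕-cancelʳ : (x t : Vec Bool n) → x ⊕ t ⊕ t ≡ x
⊕-cancelʳ x t = begin
  x ⊕ t ⊕ t     ≡⟨ zipWith-assoc xor-assoc x t t ⟩
  x ⊕ (t ⊕ t)   ≡⟨ cong (x ⊕_) (⊕-self t) ⟩
  x ⊕ origin    ≡⟨ zipWith-identityʳ xor-identityʳ x ⟩
  x             ∎
  where open ≡-Reasoning

⊕-transpose : {x t y : Vec Bool n} → x ⊕ t ≡ y → x ≡ y ⊕ t
⊕-transpose {x = x} {t} eq = trans (sym (⊕-cancelʳ x t)) (cong (_⊕ t) eq)

⊕-translate : (x y t : Vec Bool n) → (x ⊕ t) ⊕ (y ⊕ t) ≡ x ⊕ y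
⊕-translate x y t = begin
  (x ⊕ t) ⊕ (y ⊕ t)   ≡⟨ cong ((x ⊕ t) ⊕_) (zipWith-comm xor-comm y t) ⟩
  (x ⊕ t) ⊕ (t ⊕ y)   ≡⟨ sym (zipWith-assoc xor-assoc (x ⊕ t) t y) ⟩
  x ⊕ t ⊕ t ⊕ y       ≡⟨ cong (_⊕ y) (⊕-cancelʳ x t) ⟩
  x ⊕ y               ∎
  where open ≡-Reasoning

dist : Vec Bool n → Vec Bool n → ℕ
dist x y = countᵇ id (x ⊕ y)

dist-translate : (x y t : Vec Bool n) → dist (x ⊕ t) (y ⊕ t) ≡ dist x y
dist-translate x y t = cong (countᵇ id) (⊕-translate x y t)

dist-self : (x : Vec Bool n) → dist x x ≡ 0
dist-self []      = refl
dist-self (a ∷ x) rewrite xor-same a = dist-self x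

toggle : Fin n → Vec Bool n → Vec Bool n
toggle i x = updateAt x i not

toggle-⊕ : (i : Fin n) (x t : Vec Bool n) → toggle i x ⊕ t ≡ toggle i (x ⊕ t)
toggle-⊕ zero    (a ∷ x) (b ∷ t) = cong (_∷ (x ⊕ t)) (sym (not-distribˡ-xor a b))
toggle-⊕ (suc i) (a ∷ x) (b ∷ t) = cong ((a xor b) ∷_) (toggle-⊕ i x t)

dist-toggle : (i : Fin n) (x : Vec Bool n) → dist x (toggle i x) ≡ 1
dist-toggle zero    (a ∷ x) rewrite xor-inverseʳ a = cong suc (dist-self x)
dist-toggle (suc i) (a ∷ x) rewrite xor-same a = dist-toggle i x

toggle-adjacent : (i : Fin n) (x : Vec Bool n) → QAdj n x (toggle i x)
toggle-adjacent i x =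
  i , not-¬ refl ∘ (λ eq → trans eq (lookup∘updateAt i x)) ,
  λ j j≢i → sym (lookup∘updateAt′ j i j≢i x)

adjacent⇒toggle : {x y : Vec Bool n} (adj : QAdj n x y) → y ≡ toggle (proj₁ adj) x
adjacent⇒toggle {x = x} {y} (i , differ , agree) = begin
  y                              ≡⟨ sym (tabulate∘lookup y) ⟩
  tabulate (lookup y)            ≡⟨ tabulate-cong same ⟩
  tabulate (lookup (toggle i x)) ≡⟨ tabulate∘lookup (toggle i x) ⟩
  toggle i x                     ∎
  where
  open ≡-Reasoning
  same : ∀ j → lookup y j ≡ lookup (toggle i x) j
  same j with j ≟ᶠ i
  ... | yes refl = trans (¬-not (differ ∘ sym)) (sym (lookup∘updateAt i x))
  ... | no j≢i   = trans (sym (agree j j≢i)) (sym (lookup∘updateAt′ j i j≢i x))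

dist-adjacent : {x y : Vec Bool n} → QAdj n x y → dist x y ≡ 1
dist-adjacent {x = x} adj = trans (cong (dist x) (adjacent⇒toggle adj)) (dist-toggle (proj₁ adj) x)

QAdj-sym : {x y : Vec Bool n} → QAdj n x y → QAdj n y x
QAdj-sym (i , differ , agree) = i , differ ∘ sym , λ j j≢i → sym (agree j j≢i)

module _ {F : List (Star n r)} where

  walk-start-undeleted : {u v : QVertex n} → WalkAvoiding F u v → ¬ Deleted F u
  walk-start-undeleted (here ¬del)     = ¬del
  walk-start-undeleted (step ¬del _ _) = ¬del

  infixr 5 _++ʷ_

  _++ʷ_ : {u w v : QVertex n} → WalkAvoiding F u w → WalkAvoiding F w v → WalkAvoiding F u v
  here _          ++ʷ q = q
  step ¬del adj p ++ʷ q = step ¬del adj (p ++ʷ q)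

  reverseʷ : {u v : QVertex n} → WalkAvoiding F u v → WalkAvoiding F v u
  reverseʷ p = go p (here (walk-start-undeleted p))
    where
    go : {u v w : QVertex n} → WalkAvoiding F u v → WalkAvoiding F u w → WalkAvoiding F v w
    go (here _)                  acc = acc
    go (step {u} {w} ¬del adj p) acc =
      go p (step (walk-start-undeleted p) (QAdj-sym {x = u} {w} adj) acc)

near : Vec Bool n → Vec Bool n → Bool
near c x = dist c x ≤ᵇ 1

near-⊕ : (c x t : Vec Bool n) → near (c ⊕ t) (x ⊕ t) ≡ near c x
near-⊕ c x t = cong (_≤ᵇ 1) (dist-translate c x t)

star-near-centre : (s : Star n r) {w : QVertex n} → w ∈ starVertices s → T (near (centre s) w)
star-near-centre s (here refl) = ≤⇒≤ᵇ (m≤n⇒m≤1+n (≤-reflexive (dist-self (centre s))))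
star-near-centre s (there w∈leaves) =
  ≤⇒≤ᵇ (≤-reflexive (dist-adjacent {x = centre s} (All.lookup (leaves-adjacent s) w∈leaves)))

centre-deleted : {F : List (Star n r)} {s : Star n r} → s ∈ F → Deleted F (centre s)
centre-deleted = Any.map λ { refl → here refl }

undeleted-≢-deleted : {F : List (Star n r)} {u w : QVertex n} → ¬ Deleted F u → Deleted F w → u ≢ w
undeleted-≢-deleted ¬del del refl = ¬del del

everyᵇ : ∀ n → (Vec Bool n → Bool) → Bool
everyᵇ zero    p = p []
everyᵇ (suc n) p = everyᵇ n (p ∘ (true ∷_)) ∧ everyᵇ n (p ∘ (false ∷_))

everyᵇ-sound : ∀ n {p : Vec Bool n → Bool} → T (everyᵇ n p) → ∀ x → T (p x)
everyᵇ-sound zero    holds []          = holds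
everyᵇ-sound (suc n) holds (true ∷ x)  = everyᵇ-sound n (proj₁ (Equivalence.to T-∧ holds)) x
everyᵇ-sound (suc n) holds (false ∷ x) = everyᵇ-sound n (proj₂ (Equivalence.to T-∧ holds)) x

firstWhere : ∀ n → (Fin (suc n) → Bool) → Fin (suc n)
firstWhere zero    p = zero
firstWhere (suc n) p = if p zero then zero else suc (firstWhere n (p ∘ suc))

not-T : {b : Bool} → T (not b) → ¬ T b
not-T {false} _ ()

_==_ : Vec Bool n → Vec Bool n → Bool
x == y = ⌊ ≡-dec Bool._≟_ x y ⌋

-- Opaque so that types mentioning leadsToHub search-depth y are not unfolded symbolically (which blows up).
opaque
  search-depth : ℕ
  search-depth = 7

-- The search below works in coordinates where the first centre is the origin and the second is c.
module Search (c : QVertex 6) where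

  free : QVertex 6 → Bool
  free y = not (near origin y) ∧ not (near c y)

  hub : QVertex 6
  hub = if free all-ones then all-ones else true ∷ true ∷ true ∷ false ∷ false ∷ false ∷ []
    where
    all-ones : QVertex 6
    all-ones = replicate 6 true

  greedyDir : QVertex 6 → Fin 6
  greedyDir y = firstWhere 5 λ i → free (toggle i y) ∧ (dist (toggle i y) hub <ᵇ dist y hub)

  escapeDir : QVertex 6 → Fin 6
  escapeDir y = firstWhere 5 λ i → free (toggle i y)

  leadsToHub : ℕ → QVertex 6 → Bool
  leadsToHub zero    y = false
  leadsToHub (suc k) y = free y ∧ (y == hub ∨ leadsToHub k (toggle (greedyDir y) y))

  routed : QVertex 6 → Bool
  routed y = y == origin ∨ y == c ∨
             leadsToHub search-depth y ∨ leadsToHub search-depth (toggle (escapeDir y) y)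

  routed-cases : ∀ y → T (routed y) →
                 y ≡ origin ⊎ y ≡ c ⊎
                 T (leadsToHub search-depth y) ⊎ T (leadsToHub search-depth (toggle (escapeDir y) y))
  routed-cases y isRouted =
    Sum.map toWitness
      (Sum.map toWitness (Equivalence.to (T-∨ {leadsToHub search-depth y})) ∘ Equivalence.to (T-∨ {y == c}))
      (Equivalence.to (T-∨ {y == origin}) isRouted)

opaque
  unfolding search-depth

  every-vertex-routed : ∀ c y → T (Search.routed c y)
  every-vertex-routed c = everyᵇ-sound 6 (everyᵇ-sound 6 {λ c → everyᵇ 6 (Search.routed c)} _ c)

module TwoBalls {F : List (Star 6 r)} (c₁ c₂ : QVertex 6)
                (covered : ∀ w → Deleted F w → T (near c₁ w) ⊎ T (near c₂ w)) where

  open Search (c₂ ⊕ c₁)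

  meeting-point : QVertex 6
  meeting-point = hub ⊕ c₁

  free⇒undeleted : ∀ x → T (free (x ⊕ c₁)) → ¬ Deleted F x
  free⇒undeleted x isFree del with Equivalence.to T-∧ isFree | covered x del
  ... | far₁ , _ | inj₁ near₁ =
    not-T far₁ (subst T (trans (sym (near-⊕ c₁ x c₁)) (cong (λ o → near o (x ⊕ c₁)) (⊕-self c₁))) near₁)
  ... | _ , far₂ | inj₂ near₂ = not-T far₂ (subst T (sym (near-⊕ c₂ x c₁)) near₂)

  leadsToHub⇒walk : ∀ k x → T (leadsToHub k (x ⊕ c₁)) → WalkAvoiding F x meeting-point
  leadsToHub⇒walk zero    x ()
  leadsToHub⇒walk (suc k) x leads with Equivalence.to T-∧ leads
  ... | isFree , arrives with Equivalence.to T-∨ arrives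
  ... | inj₁ atHub = subst (WalkAvoiding F x) (⊕-transpose (toWitness atHub)) (here (free⇒undeleted x isFree))
  ... | inj₂ onward =
    step (free⇒undeleted x isFree) (toggle-adjacent i x)
         (leadsToHub⇒walk k (toggle i x) (subst (T ∘ leadsToHub k) (sym (toggle-⊕ i x c₁)) onward))
    where
    i : Fin 6
    i = greedyDir (x ⊕ c₁)

  walk-to-meeting-point : ∀ x → ¬ Deleted F x → x ≢ c₁ → x ≢ c₂ → WalkAvoiding F x meeting-point
  walk-to-meeting-point x ¬del x≢c₁ x≢c₂ =
    by-route (routed-cases (x ⊕ c₁) (every-vertex-routed (c₂ ⊕ c₁) (x ⊕ c₁)))
    where
    i : Fin 6
    i = escapeDir (x ⊕ c₁)
    by-route : x ⊕ c₁ ≡ origin ⊎ x ⊕ c₁ ≡ c₂ ⊕ c₁ ⊎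
               T (leadsToHub search-depth (x ⊕ c₁)) ⊎ T (leadsToHub search-depth (toggle i (x ⊕ c₁))) →
               WalkAvoiding F x meeting-point
    by-route (inj₁ atOrigin)            = ⊥-elim (x≢c₁ (trans (⊕-transpose atOrigin) (⊕-identityˡ c₁)))
    by-route (inj₂ (inj₁ atC₂))         = ⊥-elim (x≢c₂ (trans (⊕-transpose atC₂) (⊕-cancelʳ c₂ c₁)))
    by-route (inj₂ (inj₂ (inj₁ leads))) = leadsToHub⇒walk search-depth x leads
    by-route (inj₂ (inj₂ (inj₂ leads))) =
      step ¬del (toggle-adjacent i x)
           (leadsToHub⇒walk search-depth (toggle i x)
              (subst (T ∘ leadsToHub search-depth) (sym (toggle-⊕ i x c₁)) leads))

  connected-off-centres : ∀ u v → ¬ Deleted F u → ¬ Deleted F v →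
                          u ≢ c₁ → u ≢ c₂ → v ≢ c₁ → v ≢ c₂ → WalkAvoiding F u v
  connected-off-centres u v ¬del-u ¬del-v u≢c₁ u≢c₂ v≢c₁ v≢c₂ =
    walk-to-meeting-point u ¬del-u u≢c₁ u≢c₂ ++ʷ reverseʷ (walk-to-meeting-point v ¬del-v v≢c₁ v≢c₂)

  connected-if-centres-deleted : Deleted F c₁ → Deleted F c₂ → ConnectedAfterDeleting F
  connected-if-centres-deleted del₁ del₂ u v ¬del-u ¬del-v =
    connected-off-centres u v ¬del-u ¬del-v
      (undeleted-≢-deleted ¬del-u del₁) (undeleted-≢-deleted ¬del-u del₂)
      (undeleted-≢-deleted ¬del-v del₁) (undeleted-≢-deleted ¬del-v del₂)

avoiding-both : (u v : Vec Bool (suc (suc n))) → ∃ λ c → u ≢ c × v ≢ c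
avoiding-both (a ∷ u) (_ ∷ b ∷ v) =
  not a ∷ not b ∷ replicate _ false , not-¬ refl ∘ cong head , not-¬ refl ∘ cong (head ∘ tail)

lemma4p5 : (r : ℕ) → 5 ≤ r → r ≤ 6 → KappaStarAtLeast 6 r 3
lemma4p5 r _ _ [] _ u v ¬del-u ¬del-v with avoiding-both u v
... | c , u≢c , v≢c = TwoBalls.connected-off-centres c c (λ _ ()) u v ¬del-u ¬del-v u≢c u≢c v≢c v≢c
lemma4p5 r _ _ (s ∷ []) _ =
  TwoBalls.connected-if-centres-deleted (centre s) (centre s) covered centre-del centre-del
  where
  centre-del : Deleted (s ∷ []) (centre s)
  centre-del = centre-deleted (here refl)
  covered : ∀ w → Deleted (s ∷ []) w → T (near (centre s) w) ⊎ T (near (centre s) w)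
  covered w (here w∈s) = inj₁ (star-near-centre s w∈s)
lemma4p5 r _ _ (s ∷ t ∷ []) _ =
  TwoBalls.connected-if-centres-deleted (centre s) (centre t) covered
    (centre-deleted (here refl)) (centre-deleted (there (here refl)))
  where
  covered : ∀ w → Deleted (s ∷ t ∷ []) w → T (near (centre s) w) ⊎ T (near (centre t) w)
  covered w (here w∈s)         = inj₁ (star-near-centre s w∈s)
  covered w (there (here w∈t)) = inj₂ (star-near-centre t w∈t)
lemma4p5 r _ _ (_ ∷ _ ∷ _ ∷ _) (s≤s (s≤s (s≤s ())))
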